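{- Let $C$ be a global constraint on a sequence $\vec{X}$ and an additional variable $Z$, and let $f$ map sequences of values to numbers. (1) If $C$ can be expressed as $f(\vec{X})\le Z$, then $C$ is contractible iff $f$ is a non-decreasing accumulation function. (2) If $C$ can be expressed as $f(\vec{X})\ge Z$, then $C$ is contractible iff $f$ is a non-increasing accumulation function. (3) If $C$ can be expressed as $f(\vec{X})=Z$, then $C$ is contractible iff $f$ is a constant function.
   Context: A function $f$ from sequences of values to numbers is a non-decreasing (resp. non-increasing) accumulation function if $f(\vec{X}Y)\ge f(\vec{X})$ (resp. $f(\vec{X}Y)\le f(\vec{X})$) for every sequence of values $\vec{X}$ and value $Y$. The constraint $C$ is contractible if for all $n\ge0$ and all values of $Z$, $C([X_1,\ldots,X_n,Y],Z)\rightarrow C([X_1,\ldots,X_n],Z)$. -}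

module Defs where

open import Data.List using (List; _∷ʳ_)
open import Data.Integer using (ℤ; _≤_; _≥_)
open import Data.Product using (∃)
open import Relation.Binary.PropositionalEquality using (_≡_)

NonDecreasingAcc : {A : Set} → (List A → ℤ) → Set
NonDecreasingAcc {A} f = ∀ (X : List A) (Y : A) → f (X ∷ʳ Y) ≥ f X

NonIncreasingAcc : {A : Set} → (List A → ℤ) → Set
NonIncreasingAcc {A} f = ∀ (X : List A) (Y : A) → f (X ∷ʳ Y) ≤ f X

Contractible : {A : Set} → (List A → ℤ → Set) → Set
Contractible {A} C = ∀ (X : List A) (Y : A) (Z : ℤ) → C (X ∷ʳ Y) Z → C X Z

Constant : {A : Set} → (List A → ℤ) → Set
Constant {A} f = ∃ λ (c : ℤ) → ∀ (X : List A) → f X ≡ c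

-- Each of the three constraints has the form C X Z ⇔ f X ∼ Z for a reflexive,
-- transitive ∼ (namely ≤, ≥ and ≡). Contractibility is then equivalent to
-- f X ∼ f (X ∷ʳ Y): instantiate Z := f (X ∷ʳ Y) for one direction, use
-- transitivity for the other. For ≤ and ≥ this is the accumulation property; for ≡
-- it says f is invariant under appending, which by induction on the appended suffix
-- means f is constant.
module Submission where

open import Defs
open import Data.List using (List; []; _∷_; _++_; _∷ʳ_)
open import Data.List.Properties using (++-identityʳ; ∷ʳ-++)
open import Data.Integer using (ℤ; _≤_; _≥_)
open import Data.Integer.Properties using (≤-refl; ≤-trans)
open import Data.Product using (_×_; _,_)
open import Function.Bundles using (_⇔_; mk⇔; Equivalence)
open import Function.Properties.Equivalence using () renaming (trans to ⇔-trans)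
open import Level using (0ℓ)
open import Relation.Binary.Core using (Rel)
open import Relation.Binary.Definitions using (Reflexive; Transitive)
open import Relation.Binary.PropositionalEquality
  using (_≡_; refl; sym; trans; cong; module ≡-Reasoning)

open Equivalence

module _ {A : Set} {_∼_ : Rel ℤ 0ℓ} (∼-refl : Reflexive _∼_) (∼-trans : Transitive _∼_) where

  contractible⇔monotone-∷ʳ : (C : List A → ℤ → Set) (f : List A → ℤ) →
                             (∀ X Z → C X Z ⇔ (f X ∼ Z)) →
                             Contractible C ⇔ (∀ X Y → f X ∼ f (X ∷ʳ Y))
  contractible⇔monotone-∷ʳ C f C⇔ = mk⇔ monotone contractible
    where
    monotone : Contractible C → ∀ X Y → f X ∼ f (X ∷ʳ Y)
    monotone contract X Y = to (C⇔ X _) (contract X Y _ (from (C⇔ (X ∷ʳ Y) _) ∼-refl))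

    contractible : (∀ X Y → f X ∼ f (X ∷ʳ Y)) → Contractible C
    contractible mono X Y Z C[XY]Z = from (C⇔ X Z) (∼-trans (mono X Y) (to (C⇔ (X ∷ʳ Y) Z) C[XY]Z))

module _ {A : Set} (f : List A → ℤ) where

  ∷ʳ-invariant⇒++-invariant : (∀ X Y → f X ≡ f (X ∷ʳ Y)) → ∀ X Ys → f (X ++ Ys) ≡ f X
  ∷ʳ-invariant⇒++-invariant inv X []       = cong f (++-identityʳ X)
  ∷ʳ-invariant⇒++-invariant inv X (Y ∷ Ys) = begin
    f (X ++ Y ∷ Ys)    ≡⟨ cong f (∷ʳ-++ X Y Ys) ⟨
    f (X ∷ʳ Y ++ Ys)   ≡⟨ ∷ʳ-invariant⇒++-invariant inv (X ∷ʳ Y) Ys ⟩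
    f (X ∷ʳ Y)         ≡⟨ inv X Y ⟨
    f X                ∎
    where open ≡-Reasoning

  ∷ʳ-invariant⇔constant : (∀ X Y → f X ≡ f (X ∷ʳ Y)) ⇔ Constant f
  ∷ʳ-invariant⇔constant = mk⇔ constant invariant
    where
    constant : (∀ X Y → f X ≡ f (X ∷ʳ Y)) → Constant f
    constant inv = f [] , ∷ʳ-invariant⇒++-invariant inv []

    invariant : Constant f → ∀ X Y → f X ≡ f (X ∷ʳ Y)
    invariant (c , f≡c) X Y = trans (f≡c X) (sym (f≡c (X ∷ʳ Y)))

proposition7 : (∀ {A : Set} (C : List A → ℤ → Set) (f : List A → ℤ) →
                  (∀ X Z → C X Z ⇔ (f X ≤ Z)) →
                  Contractible C ⇔ NonDecreasingAcc f)
             × (∀ {A : Set} (C : List A → ℤ → Set) (f : List A → ℤ) →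
                  (∀ X Z → C X Z ⇔ (f X ≥ Z)) →
                  Contractible C ⇔ NonIncreasingAcc f)
             × (∀ {A : Set} (C : List A → ℤ → Set) (f : List A → ℤ) →
                  (∀ X Z → C X Z ⇔ (f X ≡ Z)) →
                  Contractible C ⇔ Constant f)
proposition7 =
    contractible⇔monotone-∷ʳ ≤-refl ≤-trans
  , contractible⇔monotone-∷ʳ ≤-refl (λ x≥y y≥z → ≤-trans y≥z x≥y)
  , λ C f C⇔ → ⇔-trans (contractible⇔monotone-∷ʳ refl trans C f C⇔) (∷ʳ-invariant⇔constant f)
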